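{- Let $t$ be a term, $k\in\mathbb{N}$, and $\vec{x}=(x_1,\dots,x_k)$ a list of pairwise distinct variables with $\mathrm{Fv}(t)\subseteq\{x_1,\dots,x_k\}$. (1) If $t\in\Lambda_a$ then for every positive type $Q$ there exist positive types $P_1,\dots,P_k$ and a derivation with conclusion $x_1\colon P_1,\dots,x_k\colon P_k\vdash t\colon Q$. (2) If $t\in\Lambda_n$ then there exist positive types $Q,P_1,\dots,P_k$ and a derivation with conclusion $x_1\colon P_1,\dots,x_k\colon P_k\vdash t\colon Q$. (3) If $t$ is $\rhd\mathsf{shuf}$-normal then $[\![t]\!]_{\vec{x}}\neq\emptyset$.
   Context: Terms: $t ::= x \mid \lambda x.t \mid tu$ (up to $\alpha$); values $v ::= x \mid \lambda x.t$; $\mathrm{Fv}(t)$ free variables; $t\{v/x\}$ substitution. $\Lambda_a,\Lambda_n$ defined by mutual induction: $a ::= xv \mid xa \mid an$, $n ::= v \mid a \mid (\lambda x.n)a$. Root steps: ($\beta_v$) $(\lambda x.t)v \mapsto t\{v/x\}$, $v$ a value; ($\sigma_1$) $(\lambda x.t)us \mapsto (\lambda x.ts)u$ if $x\notin\mathrm{Fv}(s)$; ($\sigma_3$) $v((\lambda x.s)u)\mapsto(\lambda x.vs)u$ if $v$ a value, $x\notin\mathrm{Fv}(v)$. Balanced contexts $B ::= [\cdot] \mid (\lambda x.B)t \mid Bt \mid tB$; $\rhd\mathsf{shuf}$-reduction is the closure of the union of the root steps under balanced contexts; normal means no step applies. Types: positive types are finite multisets $[(P_1,Q_1),\dots,(P_n,Q_n)]$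 of pairs of positive types ($\mathbf{0}$ empty, $\uplus$ union). Environments map variables to positive types (finitely many non-$\mathbf{0}$), combined pointwise by $\uplus$. Rules: (ax) $x\colon P\vdash x\colon P$; ($\lambda$) from $\Gamma_i,x\colon P_i\vdash t\colon Q_i$ ($1\le i\le n$, $n\ge0$) infer $\biguplus_i\Gamma_i\vdash\lambda x.t\colon[(P_1,Q_1),\dots,(P_n,Q_n)]$; ($@$) from $\Gamma\vdash t\colon[(P,Q)]$ and $\Delta\vdash u\colon P$ infer $\Gamma\uplus\Delta\vdash tu\colon Q$. Relational semantics: $[\![t]\!]_{\vec{x}}=\{((P_1,\dots,P_k),Q)\mid x_1\colon P_1,\dots,x_k\colon P_k\vdash t\colon Q\text{ derivable}\}$. -}

module Defs where

open import Data.Nat using (ℕ; zero; suc)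
open import Data.Fin using (Fin; zero; suc)
open import Data.List using (List; []; _∷_; _++_)
open import Data.Vec using (Vec; []; _∷_; replicate; zipWith; _[_]≔_)
open import Data.Product using (_×_; _,_; Σ; ∃)
open import Relation.Binary.PropositionalEquality using (_≡_)
open import Relation.Nullary using (¬_)

-- Terms: well-scoped de Bruijn terms (α-equivalence is built in).
-- A term  Tm k  has its free variables among the k variables in scope
-- x₁,…,xₖ (represented by Fin k; pairwise distinct by construction).

data Tm (n : ℕ) : Set where
  var : Fin n → Tm n
  lam : Tm (suc n) → Tm n
  app : Tm n → Tm n → Tm n

data Value {n : ℕ} : Tm n → Set where
  var : (x : Fin n) → Value (var x)
  lam : (t : Tm (suc n)) → Value (lam t)

data IsA {n : ℕ} : Tm n → Set
data IsN {n : ℕ} : Tm n → Set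

data IsA {n} where
  xv : (x : Fin n) {v : Tm n} → Value v → IsA (app (var x) v)
  xa : (x : Fin n) {a : Tm n} → IsA a → IsA (app (var x) a)
  an : {a m : Tm n} → IsA a → IsN m → IsA (app a m)

data IsN {n} where
  val  : {v : Tm n} → Value v → IsN v
  neu  : {a : Tm n} → IsA a → IsN a
  redx : {m : Tm (suc n)} {a : Tm n} → IsN m → IsA a → IsN (app (lam m) a)

Ren : ℕ → ℕ → Set
Ren m n = Fin m → Fin n

extR : ∀ {m n} → Ren m n → Ren (suc m) (suc n)
extR ρ zero    = zero
extR ρ (suc i) = suc (ρ i)

rename : ∀ {m n} → Ren m n → Tm m → Tm n
rename ρ (var x)   = var (ρ x)
rename ρ (lam t)   = lam (rename (extR ρ) t)
rename ρ (app t u) = app (rename ρ t) (rename ρ u)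

wk : ∀ {n} → Tm n → Tm (suc n)
wk = rename suc

Sub : ℕ → ℕ → Set
Sub m n = Fin m → Tm n

extS : ∀ {m n} → Sub m n → Sub (suc m) (suc n)
extS σ zero    = var zero
extS σ (suc i) = wk (σ i)

subst : ∀ {m n} → Sub m n → Tm m → Tm n
subst σ (var x)   = σ x
subst σ (lam t)   = lam (subst (extS σ) t)
subst σ (app t u) = app (subst σ t) (subst σ u)

single : ∀ {n} → Tm n → Sub (suc n) n
single v zero    = v
single v (suc i) = var i

_[_/0] : ∀ {n} → Tm (suc n) → Tm n → Tm n
t [ v /0] = subst (single v) t

-- Root steps.  The side conditions x ∉ Fv(s), x ∉ Fv(v) are expressed by
-- weakening s (resp. v) under the binder.

data Root {n : ℕ} : Tm n → Tm n → Set where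
  βv : (t : Tm (suc n)) {v : Tm n} → Value v →
       Root (app (lam t) v) (t [ v /0])
  σ₁ : (t : Tm (suc n)) (u s : Tm n) →
       Root (app (app (lam t) u) s) (app (lam (app t (wk s))) u)
  σ₃ : {v : Tm n} → Value v → (s : Tm (suc n)) (u : Tm n) →
       Root (app v (app (lam s) u)) (app (lam (app (wk v) s)) u)

data _⊳shuf_ {n : ℕ} : Tm n → Tm n → Set where
  root  : {t t' : Tm n} → Root t t' → t ⊳shuf t'
  lamB  : {t t' : Tm (suc n)} (u : Tm n) → t ⊳shuf t' →
          app (lam t) u ⊳shuf app (lam t') u
  appL  : {t t' : Tm n} (u : Tm n) → t ⊳shuf t' → app t u ⊳shuf app t' u
  appR  : (t : Tm n) {u u' : Tm n} → u ⊳shuf u' → app t u ⊳shuf app t u'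

ShufNormal : ∀ {n} → Tm n → Set
ShufNormal t = ∀ t' → ¬ (t ⊳shuf t')

-- Positive types: finite multisets of pairs of positive types.
-- Represented by lists; multiset equality _≈_ is defined below and the
-- typing system is closed under it (rule conv), so types/environments are
-- effectively taken up to multiset equality.

data Ty : Set where
  mk : List (Ty × Ty) → Ty

𝟎 : Ty
𝟎 = mk []

_⊎ᵗ_ : Ty → Ty → Ty
mk xs ⊎ᵗ mk ys = mk (xs ++ ys)

data _≈_ : Ty → Ty → Set
data _≈ᴸ_ : List (Ty × Ty) → List (Ty × Ty) → Set

data _≈_ where
  mk : ∀ {xs ys} → xs ≈ᴸ ys → mk xs ≈ mk ys

-- list equality up to permutation, elements compared componentwise by ≈
data _≈ᴸ_ where
  []  : [] ≈ᴸ []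
  pick : ∀ {P Q P' Q' xs} ys₁ ys₂ → P ≈ P' → Q ≈ Q' →
         xs ≈ᴸ (ys₁ ++ ys₂) → ((P , Q) ∷ xs) ≈ᴸ (ys₁ ++ (P' , Q') ∷ ys₂)

Env : ℕ → Set
Env n = Vec Ty n

_⊎ᴱ_ : ∀ {n} → Env n → Env n → Env n
_⊎ᴱ_ = zipWith _⊎ᵗ_

𝟎ᴱ : ∀ {n} → Env n
𝟎ᴱ = replicate _ 𝟎

data _≈ᴱ_ : ∀ {n} → Env n → Env n → Set where
  []  : [] ≈ᴱ []
  _∷_ : ∀ {n P P'} {Γ Γ' : Env n} → P ≈ P' → Γ ≈ᴱ Γ' → (P ∷ Γ) ≈ᴱ (P' ∷ Γ')

data _⊢_∶_ {n : ℕ} : Env n → Tm n → Ty → Set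
data Lams {n : ℕ} (t : Tm (suc n)) : Env n → List (Ty × Ty) → Set

data _⊢_∶_ {n} where
  ax   : (x : Fin n) (P : Ty) → (𝟎ᴱ [ x ]≔ P) ⊢ var x ∶ P
  lam  : ∀ {t Γ ps} → Lams t Γ ps → Γ ⊢ lam t ∶ mk ps
  app  : ∀ {t u Γ Δ P Q} → Γ ⊢ t ∶ mk ((P , Q) ∷ []) → Δ ⊢ u ∶ P →
         (Γ ⊎ᴱ Δ) ⊢ app t u ∶ Q
  conv : ∀ {t Γ Γ' Q Q'} → Γ ≈ᴱ Γ' → Q ≈ Q' → Γ ⊢ t ∶ Q → Γ' ⊢ t ∶ Q'

-- the n ≥ 0 premises Γᵢ , x : Pᵢ ⊢ t ∶ Qᵢ of the (λ) rule
data Lams {n} t where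
  []  : Lams t 𝟎ᴱ []
  _∷_ : ∀ {Γ Δ P Q ps} → (P ∷ Γ) ⊢ t ∶ Q → Lams t Δ ps →
        Lams t (Γ ⊎ᴱ Δ) ((P , Q) ∷ ps)

-- Relational semantics ⟦t⟧_x⃗ as a predicate (subset) on Env k × Ty

⟦_⟧ : ∀ {k} → Tm k → Env k × Ty → Set
⟦ t ⟧ (Ps , Q) = Ps ⊢ t ∶ Q

NonEmpty : ∀ {k} → (Env k × Ty → Set) → Set
NonEmpty S = ∃ λ e → S e

-- Λ_a terms are typable at every type and Λ_n terms at some type, by a
-- simultaneous induction: a value gets the empty type 𝟎 (axiom, or λ with no
-- premises), and in an application a u the arrow type [(P , Q)] demanded of a
-- is chosen from whatever type P the argument u was given.  A ⊳shuf-normal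
-- term lies in Λ_n: in an application whose argument is a redex (λy.s)u′ one
-- of σ₁, σ₃ fires, and a β-redex with a value argument would fire βv.
module Submission where

open import Defs
open import Data.Nat using (ℕ; suc)
open import Data.Fin using (Fin)
open import Data.Product using (_×_; ∃; ∃₂; _,_)
open import Data.Vec using (_∷_)
open import Data.List using ([]; _∷_)
open import Data.Empty using (⊥-elim)

[_⇒_] : Ty → Ty → Ty
[ P ⇒ Q ] = mk ((P , Q) ∷ [])

Typable : ∀ {n} → Tm n → Ty → Set
Typable {n} t Q = ∃ λ (Γ : Env n) → Γ ⊢ t ∶ Q

value-typable-𝟎 : ∀ {n} {v : Tm n} → Value v → Typable v 𝟎
value-typable-𝟎 (var x) = _ , ax x 𝟎
value-typable-𝟎 (lam t) = _ , lam []

var-app-typable : ∀ {n} (x : Fin n) {u : Tm n} {P : Ty} →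
                  Typable u P → (Q : Ty) → Typable (app (var x) u) Q
var-app-typable x (_ , ⊢u) Q = _ , app (ax x [ _ ⇒ Q ]) ⊢u

IsA-typable : ∀ {n} {t : Tm n} → IsA t → (Q : Ty) → Typable t Q
IsN-typable : ∀ {n} {t : Tm n} → IsN t → ∃ λ Q → Typable t Q

IsA-typable (xv x v) = var-app-typable x (value-typable-𝟎 v)
IsA-typable (xa x a) = var-app-typable x (IsA-typable a 𝟎)
IsA-typable (an a m) Q with IsN-typable m
... | P , _ , ⊢m with IsA-typable a [ P ⇒ Q ]
...   | _ , ⊢a = _ , app ⊢a ⊢m

IsN-typable (val v) = 𝟎 , value-typable-𝟎 v
IsN-typable (neu a) = 𝟎 , IsA-typable a 𝟎
IsN-typable (redx m a) with IsN-typable m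
... | Q , P ∷ _ , ⊢m with IsA-typable a P
...   | _ , ⊢a = Q , _ , app (lam (⊢m ∷ [])) ⊢a

module _ {n : ℕ} where

  appˡ-normal : ∀ {t : Tm n} u → ShufNormal (app t u) → ShufNormal t
  appˡ-normal u h _ s = h _ (appL u s)

  appʳ-normal : ∀ t {u : Tm n} → ShufNormal (app t u) → ShufNormal u
  appʳ-normal t h _ s = h _ (appR t s)

  lam-body-normal : ∀ {t : Tm (suc n)} u → ShufNormal (app (lam t) u) → ShufNormal t
  lam-body-normal u h _ s = h _ (lamB u s)

ShufNormal⇒IsN : ∀ {n} (t : Tm n) → ShufNormal t → IsN t
ShufNormal⇒IsN (var x) _ = val (var x)
ShufNormal⇒IsN (lam t) _ = val (lam t)
ShufNormal⇒IsN (app (var x) u) h with ShufNormal⇒IsN u (appʳ-normal (var x) h)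
... | val v = neu (xv x v)
... | neu a = neu (xa x a)
... | redx {s} {u′} _ _ = ⊥-elim (h _ (root (σ₃ (var x) s u′)))
ShufNormal⇒IsN (app (lam t) u) h with ShufNormal⇒IsN u (appʳ-normal (lam t) h)
... | val v = ⊥-elim (h _ (root (βv t v)))
... | neu a = redx (ShufNormal⇒IsN t (lam-body-normal u h)) a
... | redx {s} {u′} _ _ = ⊥-elim (h _ (root (σ₃ (lam t) s u′)))
ShufNormal⇒IsN (app (app t₁ t₂) u) h with ShufNormal⇒IsN (app t₁ t₂) (appˡ-normal u h)
... | neu a = neu (an a (ShufNormal⇒IsN u (appʳ-normal (app t₁ t₂) h)))
... | redx {s} {u′} _ _ = ⊥-elim (h _ (root (σ₁ s u′ u)))

mainTheorem13 : (k : ℕ) (t : Tm k) →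
    (IsA t → (Q : Ty) → ∃ λ (Ps : Env k) → Ps ⊢ t ∶ Q)
    × (IsN t → ∃₂ λ (Q : Ty) (Ps : Env k) → Ps ⊢ t ∶ Q)
    × (ShufNormal t → NonEmpty ⟦ t ⟧)
mainTheorem13 k t = IsA-typable , IsN-typable , semantics-nonempty
  where
  semantics-nonempty : ShufNormal t → NonEmpty ⟦ t ⟧
  semantics-nonempty h with IsN-typable (ShufNormal⇒IsN t h)
  ... | Q , Ps , ⊢t = (Ps , Q) , ⊢t
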